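{- If $G=(V,E)$ is a simple, connected, undirected, edge-rigid graph with at least one edge, then $d_a+d_b$ is the same for every edge $ab\in E$ (where $d_a$ is the degree of $a$). Consequently, $G$ is either regular or biregular bipartite.
   Context: Laplacian $L=\sum_{ab\in E}(e_a-e_b)(e_a-e_b)^T$; $\mathcal{L}^*(X)_{ab}=X_{aa}+X_{bb}-2X_{ab}$ for symmetric $X$. With spectral decomposition $L=\sum_{i=1}^r\lambda_iE_i$ (distinct eigenvalues $0=\lambda_1<\dots<\lambda_r$, orthogonal eigenprojectors $E_i$), $G$ is edge-rigid if for each $i\in\{2,\dots,r\}$ there is $\gamma_i>0$ with $\mathcal{L}^*(E_i)=\gamma_i\mathbf{1}$, $\mathbf{1}$ all-ones in $\mathbb{R}^E$. Biregular bipartite: bipartite with all vertices in one part of degree $d_1$ and all in the other of degree $d_2$. -}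

module Defs where

open import Level using (Level; suc; _⊔_)
open import Data.Nat as ℕ using (ℕ; zero)
open import Data.Fin using (Fin; _≟_)
import Data.Fin as F
open import Data.Fin.Properties using ()
open import Data.Bool using (Bool; true; false; if_then_else_)
open import Data.Product using (Σ; ∃; ∃-syntax; _×_; _,_)
open import Data.Sum using (_⊎_)
open import Data.Empty using (⊥)
open import Data.List using (List; []; _∷_; filter; length)
open import Data.List.Base using () renaming (allFin to finList)
open import Relation.Nullary using (¬_; yes; no; does)
open import Relation.Binary.PropositionalEquality using (_≡_; _≢_)
open import Relation.Unary using (Pred)

-- The real numbers, axiomatised as a complete ordered field
-- (any two models are isomorphic, so quantifying over all models is the
-- same as working with ℝ).  Equality is propositional equality.

record RealField : Set₁ where
  infixl 6 _+_ _-_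
  infixl 7 _*_
  infix 4 _<_
  field
    ℝ   : Set
    _+_ _*_ : ℝ → ℝ → ℝ
    -_  : ℝ → ℝ
    0ℝ 1ℝ : ℝ
    _<_ : ℝ → ℝ → Set
    +-assoc : ∀ x y z → (x + y) + z ≡ x + (y + z)
    +-comm  : ∀ x y → x + y ≡ y + x
    +-identityˡ : ∀ x → 0ℝ + x ≡ x
    -‿inverseˡ : ∀ x → (- x) + x ≡ 0ℝ
    *-assoc : ∀ x y z → (x * y) * z ≡ x * (y * z)
    *-comm  : ∀ x y → x * y ≡ y * x
    *-identityˡ : ∀ x → 1ℝ * x ≡ x
    distribˡ : ∀ x y z → x * (y + z) ≡ (x * y) + (x * z)
    0≢1 : 0ℝ ≢ 1ℝ
    inverse : ∀ x → x ≢ 0ℝ → Σ ℝ λ y → y * x ≡ 1ℝ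
    <-irrefl : ∀ x → ¬ (x < x)
    <-trans : ∀ x y z → x < y → y < z → x < z
    <-trichotomy : ∀ x y → (x < y) ⊎ ((x ≡ y) ⊎ (y < x))
    +-mono-< : ∀ x y z → x < y → x + z < y + z
    *-pos : ∀ x y → 0ℝ < x → 0ℝ < y → 0ℝ < x * y
    sup : ∀ (P : ℝ → Set) → (∃ λ x → P x) → (∃ λ b → ∀ x → P x → ¬ (b < x)) →
          ∃ λ s → (∀ x → P x → ¬ (s < x)) × (∀ b → (∀ x → P x → ¬ (b < x)) → ¬ (b < s))

  _-_ : ℝ → ℝ → ℝ
  x - y = x + (- y)

  fromℕ : ℕ → ℝ
  fromℕ zero = 0ℝ
  fromℕ (ℕ.suc k) = 1ℝ + fromℕ k

record Graph (n : ℕ) : Set where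
  field
    adj : Fin n → Fin n → Bool
    adj-sym : ∀ a b → adj a b ≡ adj b a
    adj-irrefl : ∀ a → adj a a ≡ false

module _ {n : ℕ} (G : Graph n) where
  open Graph G

  Edge : Fin n → Fin n → Set
  Edge a b = adj a b ≡ true

  deg : Fin n → ℕ
  deg a = length (filter (λ b → adj a b ≟ᵇ true) (finList n))
    where
      open import Data.Bool.Properties using () renaming (_≟_ to _≟ᵇ_)

  data Reachable : Fin n → Fin n → Set where
    here : ∀ {a} → Reachable a a
    step : ∀ {a b c} → Edge a b → Reachable b c → Reachable a c

  Connected : Set
  Connected = ∀ a b → Reachable a b

  HasEdge : Set
  HasEdge = ∃[ a ] ∃[ b ] Edge a b

  Regular : Set
  Regular = Σ ℕ λ d → (∀ a → deg a ≡ d)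

  BiregularBipartite : Set
  BiregularBipartite =
    Σ (Fin n → Bool) λ part → Σ ℕ λ d₁ → Σ ℕ λ d₂ →
      ((∀ a b → Edge a b → part a ≢ part b) ×
       (∀ a → part a ≡ true → deg a ≡ d₁) ×
       (∀ a → part a ≡ false → deg a ≡ d₂))

module Spectral (R : RealField) where
  open RealField R

  Matrix : ℕ → Set
  Matrix n = Fin n → Fin n → ℝ

  Σ[_]_ : ∀ m → (Fin m → ℝ) → ℝ
  Σ[ zero ] f = 0ℝ
  Σ[ ℕ.suc m ] f = f F.zero + Σ[ m ] (λ i → f (F.suc i))

  _·_ : ∀ {n} → Matrix n → Matrix n → Matrix n
  (A · B) a c = Σ[ _ ] (λ b → A a b * B b c)

  idM : ∀ {n} → Matrix n
  idM a b = if does (a ≟ b) then 1ℝ else 0ℝ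

  zeroM : ∀ {n} → Matrix n
  zeroM _ _ = 0ℝ

  Symmetric : ∀ {n} → Matrix n → Set
  Symmetric A = ∀ a b → A a b ≡ A b a

  -- Laplacian L = Σ_{ab∈E} (e_a - e_b)(e_a - e_b)^T, written entrywise:
  -- L_aa = d_a, L_ab = -1 if ab ∈ E, 0 otherwise (a ≠ b).
  laplacian : ∀ {n} → Graph n → Matrix n
  laplacian G a b =
    if does (a ≟ b) then fromℕ (deg G a)
    else (if Graph.adj G a b then - 1ℝ else 0ℝ)

  𝓛* : ∀ {n} → Matrix n → Fin n → Fin n → ℝ
  𝓛* X a b = X a a + X b b - (X a b + X a b)

  -- Indices are 0-based: i : Fin r.
  record SpectralDecomposition {n : ℕ} (L : Matrix n) : Set where
    field
      r : ℕ
      λ′ : Fin (ℕ.suc r) → ℝ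
      E : Fin (ℕ.suc r) → Matrix n
      λ-first : λ′ F.zero ≡ 0ℝ
      λ-increasing : ∀ i j → i F.< j → λ′ i < λ′ j
      E-symmetric : ∀ i → Symmetric (E i)
      E-idempotent : ∀ i → E i · E i ≡ E i
      E-orthogonal : ∀ i j → i ≢ j → E i · E j ≡ zeroM
      E-nonzero : ∀ i → E i ≢ zeroM
      E-resolution : (λ a b → Σ[ ℕ.suc r ] (λ i → E i a b)) ≡ idM
      L-decomp : (λ a b → Σ[ ℕ.suc r ] (λ i → λ′ i * E i a b)) ≡ L

  EdgeRigid : ∀ {n} → Graph n → Set
  EdgeRigid {n} G =
    Σ (SpectralDecomposition (laplacian G)) λ S →
      let open SpectralDecomposition S in
      ∀ (i : Fin r) → ∃ λ γ → (0ℝ < γ) ×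
        (∀ a b → Edge G a b → 𝓛* (E (F.suc i)) a b ≡ γ)

{-# OPTIONS --safe #-}
-- 𝓛* is linear and L = Σᵢ λᵢ Eᵢ with λ₁ = 0, so on every edge 𝓛*(L)_ab = Σ_{i≥2} λᵢ γᵢ is one
-- constant; read off the entries of L, 𝓛*(L)_ab = d_a + d_b + 2, and ℕ embeds injectively in an
-- ordered field, so d_a + d_b is the same on all edges. Along any walk the degrees then alternate between p = d_a₀ and q = d_b₀ for a fixed
-- edge a₀b₀, so by connectivity every degree is p or q: if p = q the graph is regular, otherwise
-- the degree-p and degree-q vertices form a bipartition.
module Submission where

open import Defs
open import Data.Nat using (ℕ)
open import Data.Product using (Σ; _×_)
open import Data.Sum using (_⊎_)
open import Relation.Binary.PropositionalEquality using (_≡_)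

open import Level using (0ℓ)
open import Algebra.Bundles using (CommutativeRing)
open import Algebra.Consequences.Propositional using (comm∧idˡ⇒id; comm∧invˡ⇒inv; comm∧distrˡ⇒distrʳ)
import Algebra.Properties.Ring as RingProperties
import Algebra.Properties.CommutativeSemigroup as CommutativeSemigroupProperties
import Data.Nat as ℕ
open import Data.Nat.Properties using (+-cancelˡ-≡)
open import Data.Fin as Fin using (Fin; zero; suc)
open import Data.Bool using (Bool; true; false)
open import Data.Product using (_,_; ∃; proj₁; proj₂)
open import Data.Sum using (inj₁; inj₂; reduce)
open import Data.Empty using (⊥-elim)
open import Relation.Nullary using (Dec; yes; no; does; contradiction)
open import Relation.Nullary.Decidable using (dec-true)
open import Relation.Binary.PropositionalEquality
  using (refl; sym; trans; cong; cong₂; subst; subst₂; isEquivalence; _≢_; module ≡-Reasoning)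

from-does≡true : ∀ {a} {A : Set a} (a? : Dec A) → does a? ≡ true → A
from-does≡true (yes a) _ = a

module RealFieldProperties (R : RealField) where
  open RealField R

  commutativeRing : CommutativeRing 0ℓ 0ℓ
  commutativeRing = record
    { Carrier = ℝ ; _≈_ = _≡_ ; _+_ = _+_ ; _*_ = _*_ ; -_ = -_ ; 0# = 0ℝ ; 1# = 1ℝ
    ; isCommutativeRing = record
      { isRing = record
        { +-isAbelianGroup = record
          { isGroup = record
            { isMonoid = record
              { isSemigroup = record
                { isMagma = record { isEquivalence = isEquivalence ; ∙-cong = cong₂ _+_ }
                ; assoc = +-assoc }
              ; identity = comm∧idˡ⇒id +-comm +-identityˡ }
            ; inverse = comm∧invˡ⇒inv +-comm -‿inverseˡ
            ; ⁻¹-cong = cong (-_) }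
          ; comm = +-comm }
        ; *-cong = cong₂ _*_
        ; *-assoc = *-assoc
        ; *-identity = comm∧idˡ⇒id *-comm *-identityˡ
        ; distrib = distribˡ , comm∧distrˡ⇒distrʳ *-comm distribˡ }
      ; *-comm = *-comm } }

  open CommutativeRing commutativeRing public using (-‿inverseʳ; zeroˡ)
  open RingProperties (CommutativeRing.ring commutativeRing) public
    using (+-cancelˡ; -‿involutive; -‿+-comm; -1*x≈-x; x[y-z]≈xy-xz)
  open CommutativeSemigroupProperties (CommutativeRing.+-commutativeSemigroup commutativeRing) public
    using (interchange)

  [x+y]-[z+w]≡[x-z]+[y-w] : ∀ x y z w → (x + y) - (z + w) ≡ (x - z) + (y - w)
  [x+y]-[z+w]≡[x-z]+[y-w] x y z w =
    trans (cong ((x + y) +_) (sym (-‿+-comm z w))) (interchange x y (- z) (- w))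

  x-[-1+-1]≡1+[1+x] : ∀ x → x - (- 1ℝ + - 1ℝ) ≡ 1ℝ + (1ℝ + x)
  x-[-1+-1]≡1+[1+x] x = begin
    x - (- 1ℝ + - 1ℝ)      ≡⟨ cong (x +_) (sym (-‿+-comm (- 1ℝ) (- 1ℝ))) ⟩
    x + (- - 1ℝ + - - 1ℝ)  ≡⟨ cong (λ t → x + (t + t)) (-‿involutive 1ℝ) ⟩
    x + (1ℝ + 1ℝ)          ≡⟨ +-comm x _ ⟩
    (1ℝ + 1ℝ) + x          ≡⟨ +-assoc 1ℝ 1ℝ x ⟩
    1ℝ + (1ℝ + x)          ∎
    where open ≡-Reasoning

  0<1 : 0ℝ < 1ℝ
  0<1 with <-trichotomy 0ℝ 1ℝ
  ... | inj₁ 0<1 = 0<1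
  ... | inj₂ (inj₁ 0≡1) = ⊥-elim (0≢1 0≡1)
  ... | inj₂ (inj₂ 1<0) =
    ⊥-elim (<-irrefl 0ℝ (<-trans 0ℝ 1ℝ 0ℝ (subst (0ℝ <_) [-1]*[-1]≡1 0<[-1]*[-1]) 1<0))
    where
    0<-1 : 0ℝ < - 1ℝ
    0<-1 = subst₂ _<_ (-‿inverseʳ 1ℝ) (+-identityˡ (- 1ℝ)) (+-mono-< 1ℝ 0ℝ (- 1ℝ) 1<0)
    [-1]*[-1]≡1 : - 1ℝ * - 1ℝ ≡ 1ℝ
    [-1]*[-1]≡1 = trans (-1*x≈-x (- 1ℝ)) (-‿involutive 1ℝ)
    0<[-1]*[-1] : 0ℝ < - 1ℝ * - 1ℝ
    0<[-1]*[-1] = *-pos _ _ 0<-1 0<-1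

  fromℕ<fromℕ-suc : ∀ k → fromℕ k < fromℕ (ℕ.suc k)
  fromℕ<fromℕ-suc k = subst (_< fromℕ (ℕ.suc k)) (+-identityˡ (fromℕ k)) (+-mono-< 0ℝ 1ℝ (fromℕ k) 0<1)

  0<fromℕ-suc : ∀ k → 0ℝ < fromℕ (ℕ.suc k)
  0<fromℕ-suc ℕ.zero = fromℕ<fromℕ-suc 0
  0<fromℕ-suc (ℕ.suc k) = <-trans _ _ _ (0<fromℕ-suc k) (fromℕ<fromℕ-suc (ℕ.suc k))

  fromℕ-injective : ∀ m k → fromℕ m ≡ fromℕ k → m ≡ k
  fromℕ-injective ℕ.zero ℕ.zero _ = refl
  fromℕ-injective ℕ.zero (ℕ.suc k) 0≡k+1 = ⊥-elim (<-irrefl 0ℝ (subst (0ℝ <_) (sym 0≡k+1) (0<fromℕ-suc k)))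
  fromℕ-injective (ℕ.suc m) ℕ.zero m+1≡0 = ⊥-elim (<-irrefl 0ℝ (subst (0ℝ <_) m+1≡0 (0<fromℕ-suc m)))
  fromℕ-injective (ℕ.suc m) (ℕ.suc k) eq = cong ℕ.suc (fromℕ-injective m k (+-cancelˡ 1ℝ _ _ eq))

  fromℕ-+ : ∀ m k → fromℕ (m ℕ.+ k) ≡ fromℕ m + fromℕ k
  fromℕ-+ ℕ.zero k = sym (+-identityˡ (fromℕ k))
  fromℕ-+ (ℕ.suc m) k = trans (cong (1ℝ +_) (fromℕ-+ m k)) (sym (+-assoc 1ℝ (fromℕ m) (fromℕ k)))

module EdgeRigidity (R : RealField) where
  open RealField R
  open RealFieldProperties R
  open Spectral R

  Σ-cong : ∀ m {f g : Fin m → ℝ} → (∀ i → f i ≡ g i) → Σ[ m ] f ≡ Σ[ m ] g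
  Σ-cong ℕ.zero f≗g = refl
  Σ-cong (ℕ.suc m) f≗g = cong₂ _+_ (f≗g zero) (Σ-cong m (λ i → f≗g (suc i)))

  𝓛*-additive : ∀ {n} (X Y : Matrix n) a b → 𝓛* (λ a b → X a b + Y a b) a b ≡ 𝓛* X a b + 𝓛* Y a b
  𝓛*-additive X Y a b = trans (cong₂ _-_ (interchange _ _ _ _) (interchange _ _ _ _)) ([x+y]-[z+w]≡[x-z]+[y-w] _ _ _ _)

  𝓛*-homogeneous : ∀ {n} c (X : Matrix n) a b → 𝓛* (λ a b → c * X a b) a b ≡ c * 𝓛* X a b
  𝓛*-homogeneous c X a b =
    trans (cong₂ _-_ (sym (distribˡ c _ _)) (sym (distribˡ c _ _))) (sym (x[y-z]≈xy-xz c _ _))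

  𝓛*-linear-combination : ∀ {n} m (c : Fin m → ℝ) (M : Fin m → Matrix n) a b →
    𝓛* (λ a b → Σ[ m ] (λ i → c i * M i a b)) a b ≡ Σ[ m ] (λ i → c i * 𝓛* (M i) a b)
  𝓛*-linear-combination ℕ.zero c M a b = -‿inverseʳ (0ℝ + 0ℝ)
  𝓛*-linear-combination (ℕ.suc m) c M a b =
    trans (𝓛*-additive (λ a b → c zero * M zero a b) (λ a b → Σ[ m ] (λ i → c (suc i) * M (suc i) a b)) a b)
          (cong₂ _+_ (𝓛*-homogeneous (c zero) (M zero) a b)
                     (𝓛*-linear-combination m (λ i → c (suc i)) (λ i → M (suc i)) a b))

  module _ {n} (G : Graph n) where

    laplacian-diagonal : ∀ a → laplacian G a a ≡ fromℕ (deg G a)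
    laplacian-diagonal a with a Fin.≟ a
    ... | yes _ = refl
    ... | no a≢a = ⊥-elim (a≢a refl)

    laplacian-edge : ∀ {a b} → Edge G a b → laplacian G a b ≡ - 1ℝ
    laplacian-edge {a} {b} ab∈E with a Fin.≟ b
    ... | yes refl with () ← trans (sym ab∈E) (Graph.adj-irrefl G a)
    ... | no _ rewrite ab∈E = refl

    𝓛*-laplacian-edge : ∀ {a b} → Edge G a b → 𝓛* (laplacian G) a b ≡ fromℕ (2 ℕ.+ (deg G a ℕ.+ deg G b))
    𝓛*-laplacian-edge {a} {b} ab∈E = begin
      laplacian G a a + laplacian G b b - (laplacian G a b + laplacian G a b)
        ≡⟨ cong₂ (λ x z → x - (z + z)) (cong₂ _+_ (laplacian-diagonal a) (laplacian-diagonal b))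
                                        (laplacian-edge ab∈E) ⟩
      fromℕ (deg G a) + fromℕ (deg G b) - (- 1ℝ + - 1ℝ)
        ≡⟨ cong (_- (- 1ℝ + - 1ℝ)) (sym (fromℕ-+ (deg G a) (deg G b))) ⟩
      fromℕ (deg G a ℕ.+ deg G b) - (- 1ℝ + - 1ℝ)
        ≡⟨ x-[-1+-1]≡1+[1+x] _ ⟩
      fromℕ (2 ℕ.+ (deg G a ℕ.+ deg G b)) ∎
      where open ≡-Reasoning

    edgeRigid⇒𝓛*-laplacian-constant : EdgeRigid G →
      ∃ λ K → ∀ {a b} → Edge G a b → 𝓛* (laplacian G) a b ≡ K
    edgeRigid⇒𝓛*-laplacian-constant (S , rigid) = K , λ {a} {b} ab∈E → begin
      𝓛* (laplacian G) a b
        ≡⟨ cong (λ L → 𝓛* L a b) (sym L-decomp) ⟩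
      𝓛* (λ a b → Σ[ ℕ.suc r ] (λ i → λ′ i * E i a b)) a b
        ≡⟨ 𝓛*-linear-combination (ℕ.suc r) λ′ E a b ⟩
      λ′ zero * 𝓛* (E zero) a b + Σ[ r ] (λ i → λ′ (suc i) * 𝓛* (E (suc i)) a b)
        ≡⟨ cong₂ _+_ (trans (cong (_* _) λ-first) (zeroˡ _))
                     (Σ-cong r (λ i → cong (λ′ (suc i) *_) (proj₂ (proj₂ (rigid i)) a b ab∈E))) ⟩
      0ℝ + K
        ≡⟨ +-identityˡ K ⟩
      K ∎
      where
      open ≡-Reasoning
      open SpectralDecomposition S
      K : ℝ
      K = Σ[ r ] (λ i → λ′ (suc i) * proj₁ (rigid i))

    edgeRigid⇒degree-sum-constant : EdgeRigid G → ∀ {a b a′ b′} → Edge G a b → Edge G a′ b′ →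
      deg G a ℕ.+ deg G b ≡ deg G a′ ℕ.+ deg G b′
    edgeRigid⇒degree-sum-constant rigid {a} {b} {a′} {b′} ab∈E a′b′∈E
      with K , 𝓛*-constant ← edgeRigid⇒𝓛*-laplacian-constant rigid =
      +-cancelˡ-≡ 2 _ _ (fromℕ-injective _ _ (begin
        fromℕ (2 ℕ.+ (deg G a ℕ.+ deg G b))      ≡⟨ sym (𝓛*-laplacian-edge ab∈E) ⟩
        𝓛* (laplacian G) a b                     ≡⟨ 𝓛*-constant ab∈E ⟩
        K                                        ≡⟨ sym (𝓛*-constant a′b′∈E) ⟩
        𝓛* (laplacian G) a′ b′                   ≡⟨ 𝓛*-laplacian-edge a′b′∈E ⟩
        fromℕ (2 ℕ.+ (deg G a′ ℕ.+ deg G b′))    ∎))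
      where open ≡-Reasoning

-- Imported only now: inside the modules above they would clash with the RealField fields _+_ and +-comm.
open import Data.Nat using (_+_)
open import Data.Nat.Properties using (+-comm)

module DegreeSumConstant {n} (G : Graph n) {p q : ℕ}
  (degree-sum : ∀ {a b} → Edge G a b → deg G a + deg G b ≡ p + q) where

  neighbour-of-degree-p : ∀ {a b} → Edge G a b → deg G a ≡ p → deg G b ≡ q
  neighbour-of-degree-p ab∈E refl = +-cancelˡ-≡ p _ _ (degree-sum ab∈E)

  neighbour-of-degree-q : ∀ {a b} → Edge G a b → deg G a ≡ q → deg G b ≡ p
  neighbour-of-degree-q ab∈E refl = +-cancelˡ-≡ q _ _ (trans (degree-sum ab∈E) (+-comm p q))

  reachable-preserves-degree-p⊎q : ∀ {a b} → Reachable G a b →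
    deg G a ≡ p ⊎ deg G a ≡ q → deg G b ≡ p ⊎ deg G b ≡ q
  reachable-preserves-degree-p⊎q here            p⊎q        = p⊎q
  reachable-preserves-degree-p⊎q (step ab∈E b⇝c) (inj₁ a-p) =
    reachable-preserves-degree-p⊎q b⇝c (inj₂ (neighbour-of-degree-p ab∈E a-p))
  reachable-preserves-degree-p⊎q (step ab∈E b⇝c) (inj₂ a-q) =
    reachable-preserves-degree-p⊎q b⇝c (inj₁ (neighbour-of-degree-q ab∈E a-q))

  module _ (connected : Connected G) {v₀} (v₀-p : deg G v₀ ≡ p) where

    degree-p⊎q : ∀ v → deg G v ≡ p ⊎ deg G v ≡ q
    degree-p⊎q v = reachable-preserves-degree-p⊎q (connected v₀ v) (inj₁ v₀-p)

    regular : p ≡ q → Regular G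
    regular refl = p , λ v → reduce (degree-p⊎q v)

    biregularBipartite : p ≢ q → BiregularBipartite G
    biregularBipartite p≢q = part , p , q , edge-crosses-parts , part-true , part-false
      where
      part : Fin n → Bool
      part v = does (deg G v ℕ.≟ p)

      degree-p⇒part-true : ∀ {v} → deg G v ≡ p → part v ≡ true
      degree-p⇒part-true {v} = dec-true (deg G v ℕ.≟ p)

      part-true : ∀ v → part v ≡ true → deg G v ≡ p
      part-true v = from-does≡true (deg G v ℕ.≟ p)

      part-false : ∀ v → part v ≡ false → deg G v ≡ q
      part-false v v-false with degree-p⊎q v
      ... | inj₁ v-p = contradiction (trans (sym (degree-p⇒part-true v-p)) v-false) λ ()
      ... | inj₂ v-q = v-q

      edge-crosses-parts : ∀ a b → Edge G a b → part a ≢ part b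
      edge-crosses-parts a b ab∈E same-part with degree-p⊎q a
      ... | inj₁ a-p = p≢q (trans (sym b-p) (neighbour-of-degree-p ab∈E a-p))
        where
        b-p : deg G b ≡ p
        b-p = part-true b (trans (sym same-part) (degree-p⇒part-true a-p))
      ... | inj₂ a-q = p≢q (trans (sym a-p) a-q)
        where
        a-p : deg G a ≡ p
        a-p = part-true a (trans same-part (degree-p⇒part-true (neighbour-of-degree-q ab∈E a-q)))

    regular⊎biregularBipartite : Regular G ⊎ BiregularBipartite G
    regular⊎biregularBipartite with p ℕ.≟ q
    ... | yes p≡q = inj₁ (regular p≡q)
    ... | no p≢q = inj₂ (biregularBipartite p≢q)

mainTheorem10 : (R : RealField) → (n : ℕ) → (G : Graph n) →
    Connected G → HasEdge G → Spectral.EdgeRigid R G →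
    Σ ℕ (λ c → ∀ a b → Edge G a b → deg G a + deg G b ≡ c) ×
    (Regular G ⊎ BiregularBipartite G)
mainTheorem10 R n G connected (a₀ , b₀ , a₀b₀∈E) rigid =
  (deg G a₀ + deg G b₀ , λ _ _ → degree-sum) ,
  DegreeSumConstant.regular⊎biregularBipartite G degree-sum connected refl
  where
  degree-sum : ∀ {a b} → Edge G a b → deg G a + deg G b ≡ deg G a₀ + deg G b₀
  degree-sum ab∈E = EdgeRigidity.edgeRigid⇒degree-sum-constant R G rigid ab∈E a₀b₀∈E
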